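{- Every parametric class $\mathbf{K}$ enjoys the Adoptive Property.
   Context: Let $\Sigma$ be a relational signature. A first-order sentence is parametric if it is a conjunction of sentences of the form $\forall x_1\cdots\forall x_m\big((\bigwedge_{1\le i<j\le m}x_i\ne x_j)\to\psi\big)$ where $m>0$ and $\psi$ is a Boolean combination of atomic formulas $R(y_1,\dots,y_n)$ with $R\in\Sigma$ and $\{y_1,\dots,y_n\}=\{x_1,\dots,x_m\}$. A class $\mathbf{K}$ is parametric if $\mathbf{K}=\mathrm{Mod}(\phi)$, the class of all finite $\Sigma$-structures with underlying set a subset of $\mathbb{N}$ satisfying $\phi$, for a parametric sentence $\phi$. For a structure $M$, $|M|$ is its underlying set and $R^M$ the interpretation of $R$. The $n$-frame $A^{(n)}$ of $A$ has the same underlying set, the same interpretations of relations of arity $\le n$, and empty interpretations of higher-arity relations. Adoptive Property (for a class $\mathbf{K}$): whenever $B\in\mathbf{K}$, $A\in\mathbf{K}$ is an (induced) substructure of $B$ of cardinality $n$, and $A'\in\mathbf{K}$ is a structure on $|A|$ with $(A')^{(n-1)}=A^{(n-1)}$, there is $B'\in\mathbf{K}$ with $|B'|=|B|$, $(B')^{(n-1)}=B^{(n-1)}$, and $R^{B'}=(R^B\setminus|A|^n)\cup R^{A'}$ for every $n$-ary $R\in\Sigma$. -}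

module Defs where

open import Data.Nat using (ℕ; _<_; _<ᵇ_)
open import Data.Fin using (Fin)
open import Data.Bool using (Bool; true; false; _∧_; _∨_; not)
open import Data.List using (List; length)
open import Data.List.Membership.Propositional using (_∈_)
open import Data.List.Relation.Unary.All using (All)
open import Data.List.Relation.Unary.Unique.Propositional using (Unique)
open import Data.Product using (_×_; ∃; _,_)
open import Data.Sum using (_⊎_)
open import Function.Bundles using (_⇔_)
open import Relation.Binary.PropositionalEquality using (_≡_)
open import Relation.Nullary using (¬_)

record Signature : Set₁ where
  field
    Sym   : Set
    arity : Sym → ℕ
open Signature public

-- The underlying set is given as a duplicate-free list; relations are
-- decidable (Bool-valued) predicates on tuples, true only on tuples
-- whose entries lie in the underlying set.
record Structure (Σ : Signature) : Set where
  field
    dom    : List ℕ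
    uniq   : Unique dom
    rel    : (R : Sym Σ) → (Fin (arity Σ R) → ℕ) → Bool
    closed : ∀ R t → rel R t ≡ true → ∀ i → t i ∈ dom
open Structure public

module _ {Σ : Signature} where

  card : Structure Σ → ℕ
  card M = length (dom M)

  SameDom : Structure Σ → Structure Σ → Set
  SameDom M N = ∀ x → (x ∈ dom M) ⇔ (x ∈ dom N)

  _≈ₛ_ : Structure Σ → Structure Σ → Set
  M ≈ₛ N = SameDom M N × (∀ R t → rel M R t ≡ rel N R t)

  private
    ∧-trueʳ : ∀ a b → a ∧ b ≡ true → b ≡ true
    ∧-trueʳ true  b p = p
    ∧-trueʳ false b ()

  -- frameBelow n M  is the (n-1)-frame M^(n-1): relations of arity < n
  -- (i.e. ≤ n-1) are kept, higher-arity relations are made empty.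
  -- (For n = 0 every relation is emptied, matching "arity ≤ -1".)
  frameBelow : ℕ → Structure Σ → Structure Σ
  frameBelow n M = record
    { dom    = dom M
    ; uniq   = uniq M
    ; rel    = λ R t → (arity Σ R <ᵇ n) ∧ rel M R t
    ; closed = λ R t p → closed M R t (∧-trueʳ (arity Σ R <ᵇ n) (rel M R t) p)
    }

  _⊑_ : Structure Σ → Structure Σ → Set
  A ⊑ B = (∀ x → x ∈ dom A → x ∈ dom B)
        × (∀ R (t : Fin (arity Σ R) → ℕ) → (∀ i → t i ∈ dom A) → rel A R t ≡ rel B R t)

-- Boolean combinations of atomic formulas R(y₁,…,yₖ) in the variables
-- x₁,…,xₘ (variables = Fin m), where each atom uses ALL m variables,
-- i.e. {y₁,…,yₖ} = {x₁,…,xₘ} (the map y is onto Fin m).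
data BForm (Σ : Signature) (m : ℕ) : Set where
  atom : (R : Sym Σ) (y : Fin (arity Σ R) → Fin m) →
         (∀ j → ∃ λ i → y i ≡ j) → BForm Σ m
  neg  : BForm Σ m → BForm Σ m
  conj : BForm Σ m → BForm Σ m → BForm Σ m
  disj : BForm Σ m → BForm Σ m → BForm Σ m

-- One conjunct  ∀x₁…∀xₘ ((⋀_{i<j} xᵢ ≠ xⱼ) → ψ)  with m > 0.
record Clause (Σ : Signature) : Set where
  constructor clause
  field
    m   : ℕ
    m>0 : 0 < m
    ψ   : BForm Σ m
open Clause public

ParametricSentence : Signature → Set
ParametricSentence Σ = List (Clause Σ)

module _ {Σ : Signature} where

  eval : (M : Structure Σ) {m : ℕ} → (Fin m → ℕ) → BForm Σ m → Bool
  eval M x (atom R y _) = rel M R (λ i → x (y i))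
  eval M x (neg φ)      = not (eval M x φ)
  eval M x (conj φ ψ)   = eval M x φ ∧ eval M x ψ
  eval M x (disj φ ψ)   = eval M x φ ∨ eval M x ψ

  SatClause : Structure Σ → Clause Σ → Set
  SatClause M c = (x : Fin (m c) → ℕ) → (∀ j → x j ∈ dom M) →
                  (∀ i j → i ≢ j → x i ≢ x j) → eval M x (ψ c) ≡ true
    where
    open import Relation.Binary.PropositionalEquality using (_≢_)

  Mod : ParametricSentence Σ → Structure Σ → Set
  Mod φ M = All (SatClause M) φ

  AdoptiveProperty : (Structure Σ → Set) → Set
  AdoptiveProperty K =
    (B A A' : Structure Σ) → K B → K A → A ⊑ B → K A' →
    SameDom A' A → frameBelow (card A) A' ≈ₛ frameBelow (card A) A →
    ∃ λ (B' : Structure Σ) → K B' × SameDom B' B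
      × frameBelow (card A) B' ≈ₛ frameBelow (card A) B
      × (∀ R → arity Σ R ≡ card A → ∀ (t : Fin (arity Σ R) → ℕ) →
           (rel B' R t ≡ true) ⇔
           ((rel B R t ≡ true × ¬ (∀ i → t i ∈ dom A)) ⊎ rel A' R t ≡ true))

module Submission where

open import Defs
open import Data.Nat using (ℕ; _<ᵇ_)
open import Data.Nat.Properties using (_≟_)
open import Data.Fin using (Fin)
open import Data.Fin.Properties using (all?)
open import Data.Bool using (Bool; true; false; _∧_; _∨_; not)
open import Data.List.Membership.Propositional using (_∈_)
open import Data.List.Membership.DecPropositional _≟_ using (_∈?_)
import Data.List.Relation.Unary.All as All
open import Data.Product using (_×_; ∃; _,_; proj₁; proj₂)
open import Data.Product.Function.NonDependent.Propositional using (_×-⇔_)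
open import Data.Sum using (_⊎_; inj₁; inj₂)
open import Data.Sum.Function.Propositional using (_⊎-⇔_)
open import Data.Empty using (⊥-elim)
open import Function.Bundles using (_⇔_; mk⇔; Equivalence)
open import Function.Construct.Identity using (⇔-id)
open import Function.Construct.Composition using (_⇔-∘_)
open import Function.Related.TypeIsomorphisms using (¬-cong-⇔)
open import Relation.Binary.PropositionalEquality using (_≡_; refl; trans; subst; cong; cong₂)
open import Relation.Nullary using (¬_; Dec; yes; no)

-- Idea: let B' agree with A' on every tuple from |A| (of any arity) and with
-- B elsewhere. Lower arities are unchanged because A' and A share their
-- (n-1)-frame. Since every atom of a parametric clause mentions all of its
-- variables, an injective assignment either lands inside |A|, where every
-- atom is read in A', or not, where every atom is read in B; so each clause
-- holds in B' because it holds in A' resp. in B.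

∀-onto : {m k : ℕ} (P : Fin m → Set) (y : Fin k → Fin m) →
         (∀ j → ∃ λ i → y i ≡ j) → (∀ i → P (y i)) → ∀ j → P j
∀-onto P y onto p j = subst P (proj₂ (onto j)) (p (proj₁ (onto j)))

module Patch {Σ : Signature} (B C : Structure Σ) (C⊆B : ∀ x → x ∈ dom C → x ∈ dom B) where

  Inside : ∀ {k} → (Fin k → ℕ) → Set
  Inside t = ∀ i → t i ∈ dom C

  inside? : ∀ {k} (t : Fin k → ℕ) → Dec (Inside t)
  inside? t = all? (λ i → t i ∈? dom C)

  patchRel : (R : Sym Σ) → (Fin (arity Σ R) → ℕ) → Bool
  patchRel R t with inside? t
  ... | yes _ = rel C R t
  ... | no _  = rel B R t

  patchRel-closed : ∀ R t → patchRel R t ≡ true → ∀ i → t i ∈ dom B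
  patchRel-closed R t p i with inside? t
  ... | yes t⊆C = C⊆B (t i) (t⊆C i)
  ... | no _    = closed B R t p i

  patch : Structure Σ
  patch = record { dom = dom B ; uniq = uniq B ; rel = patchRel ; closed = patchRel-closed }

  eval-patch-inside : ∀ {m} (x : Fin m → ℕ) → Inside x → (ψ : BForm Σ m) →
                      eval patch x ψ ≡ eval C x ψ
  eval-patch-inside x x⊆C (atom R y onto) with inside? (λ i → x (y i))
  ... | yes _  = refl
  ... | no x∘y⊈C = ⊥-elim (x∘y⊈C (λ i → x⊆C (y i)))
  eval-patch-inside x x⊆C (neg ψ)    = cong not (eval-patch-inside x x⊆C ψ)
  eval-patch-inside x x⊆C (conj ψ χ) = cong₂ _∧_ (eval-patch-inside x x⊆C ψ) (eval-patch-inside x x⊆C χ)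
  eval-patch-inside x x⊆C (disj ψ χ) = cong₂ _∨_ (eval-patch-inside x x⊆C ψ) (eval-patch-inside x x⊆C χ)

  eval-patch-outside : ∀ {m} (x : Fin m → ℕ) → ¬ Inside x → (ψ : BForm Σ m) →
                       eval patch x ψ ≡ eval B x ψ
  eval-patch-outside x x⊈C (atom R y onto) with inside? (λ i → x (y i))
  ... | no _     = refl
  ... | yes x∘y⊆C = ⊥-elim (x⊈C (∀-onto (λ j → x j ∈ dom C) y onto x∘y⊆C))
  eval-patch-outside x x⊈C (neg ψ)    = cong not (eval-patch-outside x x⊈C ψ)
  eval-patch-outside x x⊈C (conj ψ χ) = cong₂ _∧_ (eval-patch-outside x x⊈C ψ) (eval-patch-outside x x⊈C χ)
  eval-patch-outside x x⊈C (disj ψ χ) = cong₂ _∨_ (eval-patch-outside x x⊈C ψ) (eval-patch-outside x x⊈C χ)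

  patch-satisfies : (c : Clause Σ) → SatClause B c → SatClause C c → SatClause patch c
  patch-satisfies c B⊨c C⊨c x x∈B injective with inside? x
  ... | yes x⊆C = trans (eval-patch-inside x x⊆C (ψ c)) (C⊨c x x⊆C injective)
  ... | no x⊈C  = trans (eval-patch-outside x x⊈C (ψ c)) (B⊨c x x∈B injective)

  patch-models : (φ : ParametricSentence Σ) → Mod φ B → Mod φ C → Mod φ patch
  patch-models φ B⊨φ C⊨φ = All.zipWith (λ {c} (B⊨c , C⊨c) → patch-satisfies c B⊨c C⊨c) (B⊨φ , C⊨φ)

  frameBelow-patch : ∀ n → (∀ R t → (arity Σ R <ᵇ n) ≡ true → Inside t → rel C R t ≡ rel B R t) →
                     frameBelow n patch ≈ₛ frameBelow n B
  frameBelow-patch n C≡B = (λ _ → ⇔-id _) , agree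
    where
    agree : ∀ R t → ((arity Σ R <ᵇ n) ∧ patchRel R t) ≡ ((arity Σ R <ᵇ n) ∧ rel B R t)
    agree R t with arity Σ R <ᵇ n in low | inside? t
    ... | false | _        = refl
    ... | true  | yes t⊆C = C≡B R t low t⊆C
    ... | true  | no _    = refl

  patchRel-true⇔ : ∀ R t → (patchRel R t ≡ true) ⇔
                   ((rel B R t ≡ true × ¬ Inside t) ⊎ rel C R t ≡ true)
  patchRel-true⇔ R t with inside? t
  ... | yes t⊆C = mk⇔ inj₂ λ { (inj₁ (_ , t⊈C)) → ⊥-elim (t⊈C t⊆C) ; (inj₂ Ct) → Ct }
  ... | no t⊈C  = mk⇔ (λ Bt → inj₁ (Bt , t⊈C))
                      λ { (inj₁ (Bt , _)) → Bt ; (inj₂ Ct) → ⊥-elim (t⊈C (closed C R t Ct)) }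

proposition3p6 : (Σ : Signature) (φ : ParametricSentence Σ) → AdoptiveProperty (Mod φ)
proposition3p6 Σ φ B A A' B⊨φ _ (A⊆B , A≡B) A'⊨φ A'~A (_ , A'≡A) =
  patch , patch-models φ B⊨φ A'⊨φ , (λ _ → ⇔-id _) , frameBelow-patch (card A) A'≡B
        , λ R _ t → ((⇔-id _ ×-⇔ ¬-cong-⇔ (inside⇔ t)) ⊎-⇔ ⇔-id _) ⇔-∘ patchRel-true⇔ R t
  where
  to-A : ∀ x → x ∈ dom A' → x ∈ dom A
  to-A x = Equivalence.to (A'~A x)

  open Patch B A' (λ x x∈A' → A⊆B x (to-A x x∈A'))

  inside⇔ : ∀ {k} (t : Fin k → ℕ) → Inside t ⇔ (∀ i → t i ∈ dom A)
  inside⇔ t = mk⇔ (λ t⊆A' i → to-A (t i) (t⊆A' i)) (λ t⊆A i → Equivalence.from (A'~A (t i)) (t⊆A i))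

  A'≡B : ∀ R t → (arity Σ R <ᵇ card A) ≡ true → Inside t → rel A' R t ≡ rel B R t
  A'≡B R t low t⊆A' = trans (subst (λ b → (b ∧ rel A' R t) ≡ (b ∧ rel A R t)) low (A'≡A R t))
                            (A≡B R t (Equivalence.to (inside⇔ t) t⊆A'))
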